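{- Work in Bishop-style constructive mathematics. The following are equivalent: (1) every monotone $\Pi^0_1$ bar of the binary fan $\{0,1\}^*$ is uniform; (2) every c-bar of the binary fan $\{0,1\}^*$ is uniform; (3) for every fan $T$, every c-bar of $T$ is uniform; (4) for every fan $T$, every c-bar of the universal spread $\mathbb{N}^*$ is uniform with respect to $T$.
   Context: $\mathbb{N}^*$ is the set of finite sequences of natural numbers, $\{0,1\}^*$ the finite binary sequences, $a*b$ concatenation, $\overline{\alpha}n$ the initial segment of length $n$ of $\alpha$. A tree is an inhabited decidable subset of $\mathbb{N}^*$ closed under initial segments. A spread is a tree $S$ with $\forall a\in S\,\exists n\,(a*\langle n\rangle\in S)$; a path of $S$ is $\alpha$ with $\forall n\,(\overline{\alpha}n\in S)$. A fan is a spread $T$ with $\forall a\in T\,\exists N\,\forall n\,[a*\langle n\rangle\in T\to n\le N]$. For a spread $S$, $P\subseteq S$ is a bar of $S$ if every path $\alpha$ of $S$ has some $n$ with $\overline{\alpha}n\in P$; a uniform bar if there is $N$ such that every path of $S$ has some $n\le N$ with $\overline{\alpha}n\in P$; $\Pi^0_1$ if $P=\bigcap_n B_n$ with each $B_n\subseteq S$ decidable; monotone if $a\in P$, $a*b\in S$ imply $a*b\in P$. A subset $P\subseteq S$ is a c-set if there is a decidable $D\subseteq\mathbb{N}^*$ with $P(a)\leftrightarrow\forall b\in\mathbb{N}^*\,(a*b\in D)$ for all $a\in S$; a c-bar is a c-set that is a bar. For a fan $T$, a bar $P$ of $\mathbb{N}^*$ is uniform with respect to $T$ if $P\cap T$ is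 a uniform bar of $T$. -}

module Defs where

open import Data.Nat using (ℕ; _≤_; _≤ᵇ_)
open import Data.Bool using (Bool; true; false; _∧_)
open import Data.List using (List; []; _∷_; _++_; [_]; map; upTo)
open import Data.Product using (Σ; ∃; ∃-syntax; _×_; _,_)
open import Relation.Binary.PropositionalEquality using (_≡_)
open import Function.Bundles using (_⇔_)

Seq : Set
Seq = List ℕ

Path : Set
Path = ℕ → ℕ

initSeg : Path → ℕ → Seq
initSeg α n = map α (upTo n)

DecSet : Set
DecSet = Seq → Bool

_∈ᵈ_ : Seq → DecSet → Set
a ∈ᵈ S = S a ≡ true

Subset : Set₁
Subset = Seq → Set

_⊆_ : Subset → DecSet → Set
P ⊆ S = ∀ a → P a → a ∈ᵈ S

IsTree : DecSet → Set
IsTree S = (∃[ a ] a ∈ᵈ S) × (∀ a b → (a ++ b) ∈ᵈ S → a ∈ᵈ S)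

IsSpread : DecSet → Set
IsSpread S = IsTree S × (∀ a → a ∈ᵈ S → ∃[ n ] (a ++ [ n ]) ∈ᵈ S)

IsFan : DecSet → Set
IsFan T = IsSpread T × (∀ a → a ∈ᵈ T → ∃[ N ] (∀ n → (a ++ [ n ]) ∈ᵈ T → n ≤ N))

IsPathOf : DecSet → Path → Set
IsPathOf S α = ∀ n → initSeg α n ∈ᵈ S

IsBar : DecSet → Subset → Set
IsBar S P = P ⊆ S × (∀ α → IsPathOf S α → ∃[ n ] P (initSeg α n))

IsUniformBar : DecSet → Subset → Set
IsUniformBar S P =
  P ⊆ S × (∃[ N ] (∀ α → IsPathOf S α → ∃[ n ] (n ≤ N × P (initSeg α n))))

IsΠ⁰₁ : DecSet → Subset → Set
IsΠ⁰₁ S P = Σ (ℕ → DecSet) λ B → ((∀ n a → a ∈ᵈ B n → a ∈ᵈ S) × (∀ a → P a ⇔ (∀ n → a ∈ᵈ B n)))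

IsMonotone : DecSet → Subset → Set
IsMonotone S P = ∀ a b → P a → (a ++ b) ∈ᵈ S → P (a ++ b)

IsCSet : DecSet → Subset → Set
IsCSet S P = P ⊆ S × (Σ DecSet λ D → (∀ a → a ∈ᵈ S → (P a ⇔ (∀ b → (a ++ b) ∈ᵈ D))))

IsCBar : DecSet → Subset → Set
IsCBar S P = IsCSet S P × IsBar S P

Bin : DecSet
Bin [] = true
Bin (x ∷ a) = (x ≤ᵇ 1) ∧ Bin a

Univ : DecSet
Univ _ = true

_∩_ : Subset → DecSet → Subset
(P ∩ T) a = P a × a ∈ᵈ T

UniformWrt : DecSet → Subset → Set
UniformWrt T P = IsUniformBar T (P ∩ T)

Principle1 : Set₁
Principle1 = ∀ (P : Subset) → IsMonotone Bin P → IsΠ⁰₁ Bin P → IsBar Bin P → IsUniformBar Bin P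

Principle2 : Set₁
Principle2 = ∀ (P : Subset) → IsCBar Bin P → IsUniformBar Bin P

Principle3 : Set₁
Principle3 = ∀ (T : DecSet) → IsFan T → ∀ (P : Subset) → IsCBar T P → IsUniformBar T P

Principle4 : Set₁
Principle4 = ∀ (T : DecSet) → IsFan T → ∀ (P : Subset) → IsCBar Univ P → UniformWrt T P

module Submission where

-- The easy implications are (3) ⇒ (2) (take T = {0,1}*) and (3) ⇒ (4) (a c-bar P of ℕ*
-- restricts to the c-bar P ∩ T of T).  For (2) ⇒ (1) and (4) ⇒ (1) we turn a monotone
-- Π⁰₁ set P = ⋂ Bₙ ⊆ {0,1}* into a c-set using a "marker test": a sequence a * ⟨n+2⟩ with
-- a binary is rejected iff a ∉ Bₙ, and all other sequences are accepted; on binary nodes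
-- P a holds iff all extensions of a pass the test, and every non-binary node of ℕ* passes
-- vacuously, which yields a c-bar of ℕ*.  The main step (1) ⇒ (3) codes an arbitrary fan T
-- into {0,1}*: the branching bounds of T give a bound M n on the n-th value of all paths,
-- α n is written in unary in a block of M n + 1 bits, and for a c-bar P of T the set Q of
-- binary codes whose decoding has left T or entered P is a monotone Π⁰₁ bar of {0,1}*
-- (it bars every code because decoded sequences are shadowed by paths of T).

open import Defs
open import Data.Bool using (Bool; true; false; _∧_; _∨_; not)
open import Data.Bool.Properties using (∧-assoc; ∧-conicalˡ; ∧-conicalʳ)
open import Data.List using ([]; _∷_; _++_; [_]; map; upTo; applyUpTo; length)
open import Data.List.Properties
  using (map-upTo; applyUpTo-∷ʳ; map-∘; length-map; length-upTo; ++-assoc; length-++; ++-identityʳ)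
open import Data.List.Relation.Unary.All as All using (All; []; _∷_)
open import Data.List.Relation.Unary.All.Properties using (map⁺; all-upTo)
open import Data.Nat using (ℕ; zero; suc; _+_; _∸_; _≤_; _<_; _≤ᵇ_; z≤n; s≤s; z<s; _⊔_; _⊓_; _≤?_; _<?_)
open import Data.Nat.Properties
open import Data.Product using (∃-syntax; _×_; _,_; proj₁; proj₂)
open import Data.Sum using (_⊎_; inj₁; inj₂)
open import Function using (_∘_; id)
open import Function.Bundles using (_⇔_; mk⇔; Equivalence)
open import Relation.Nullary using (yes; no; contradiction)
open import Relation.Binary.Definitions using (tri<; tri≈; tri>)
open import Relation.Binary.PropositionalEquality hiding ([_])

open Equivalence
open ≡-Reasoning

∧-intro : ∀ {a b} → a ≡ true → b ≡ true → a ∧ b ≡ true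
∧-intro refl refl = refl

initSeg-suc : ∀ (α : Path) n → initSeg α (suc n) ≡ initSeg α n ++ [ α n ]
initSeg-suc α n = begin
  initSeg α (suc n)         ≡⟨ map-upTo α (suc n) ⟩
  applyUpTo α (suc n)       ≡⟨ applyUpTo-∷ʳ α n ⟨
  applyUpTo α n ++ [ α n ]  ≡⟨ cong (_++ [ α n ]) (map-upTo α n) ⟨
  initSeg α n ++ [ α n ]    ∎

length-initSeg : ∀ (α : Path) n → length (initSeg α n) ≡ n
length-initSeg α n = trans (length-map α (upTo n)) (length-upTo n)

initSeg-cong : ∀ (f g : Path) k → (∀ i → i < k → f i ≡ g i) → initSeg f k ≡ initSeg g k
initSeg-cong f g zero _ = refl
initSeg-cong f g (suc k) f≐g = begin
  initSeg f (suc k)       ≡⟨ initSeg-suc f k ⟩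
  initSeg f k ++ [ f k ]  ≡⟨ cong₂ (λ u x → u ++ [ x ]) below (f≐g k (n<1+n k)) ⟩
  initSeg g k ++ [ g k ]  ≡⟨ initSeg-suc g k ⟨
  initSeg g (suc k)       ∎
  where
  below : initSeg f k ≡ initSeg g k
  below = initSeg-cong f g k (λ i i<k → f≐g i (m<n⇒m<1+n i<k))

initSeg-prefix : ∀ (f : Path) {k k'} → k ≤ k' → ∃[ e ] initSeg f k' ≡ initSeg f k ++ e
initSeg-prefix f {k} {k'} k≤k' with m≤n⇒m<n∨m≡n k≤k'
... | inj₂ refl = [] , sym (++-identityʳ (initSeg f k))
initSeg-prefix f {k} {suc k'} _ | inj₁ (s≤s k≤k') =
  let (e , eq) = initSeg-prefix f k≤k' in
  e ++ [ f k' ] , (begin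
    initSeg f (suc k')               ≡⟨ initSeg-suc f k' ⟩
    initSeg f k' ++ [ f k' ]         ≡⟨ cong (_++ [ f k' ]) eq ⟩
    (initSeg f k ++ e) ++ [ f k' ]   ≡⟨ ++-assoc (initSeg f k) e [ f k' ] ⟩
    initSeg f k ++ (e ++ [ f k' ])   ∎)

All-initSeg : ∀ {R : ℕ → Set} (α : Path) n → (∀ i → i < n → R (α i)) → All R (initSeg α n)
All-initSeg α n h = map⁺ (All.map (λ {i} → h i) (all-upTo n))

-- the p-th entry of a finite sequence, read as 0 out of range
nth : Seq → ℕ → ℕ
nth [] _ = 0
nth (x ∷ a) zero = x
nth (x ∷ a) (suc p) = nth a p

nth-++ : ∀ a b p → p < length a → nth (a ++ b) p ≡ nth a p
nth-++ (x ∷ a) b zero _ = refl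
nth-++ (x ∷ a) b (suc p) (s≤s p<) = nth-++ a b p p<

nth-initSeg : ∀ (β : Path) m p → p < m → nth (initSeg β m) p ≡ β p
nth-initSeg β m p p<m = trans (cong (λ a → nth a p) (map-upTo β m)) (nth-applyUpTo β m p p<m)
  where
  nth-applyUpTo : ∀ (β : Path) m p → p < m → nth (applyUpTo β m) p ≡ β p
  nth-applyUpTo β (suc m) zero _ = refl
  nth-applyUpTo β (suc m) (suc p) (s≤s p<m) = nth-applyUpTo (β ∘ suc) m p p<m

Bin-++ : ∀ a b → Bin (a ++ b) ≡ Bin a ∧ Bin b
Bin-++ [] b = refl
Bin-++ (x ∷ a) b = trans (cong ((x ≤ᵇ 1) ∧_) (Bin-++ a b)) (sym (∧-assoc (x ≤ᵇ 1) (Bin a) (Bin b)))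

Bin-prefix : ∀ a b → Bin (a ++ b) ≡ true → Bin a ≡ true
Bin-prefix a b p = ∧-conicalˡ (Bin a) (Bin b) (trans (sym (Bin-++ a b)) p)

Bin-suffix : ∀ a b → Bin (a ++ b) ≡ true → Bin b ≡ true
Bin-suffix a b p = ∧-conicalʳ (Bin a) (Bin b) (trans (sym (Bin-++ a b)) p)

Bin-join : ∀ a b → Bin a ≡ true → Bin b ≡ true → Bin (a ++ b) ≡ true
Bin-join a b p q = trans (Bin-++ a b) (∧-intro p q)

bit≤1 : ∀ x → Bin [ x ] ≡ true → x ≤ 1
bit≤1 zero _ = z≤n
bit≤1 (suc zero) _ = s≤s z≤n
bit≤1 (suc (suc x)) ()

binFan : IsFan Bin
binFan = ((([] , refl) , Bin-prefix) , λ a p → 0 , Bin-join a [ 0 ] p refl)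
       , λ a _ → 1 , λ x q → bit≤1 x (Bin-suffix a [ x ] q)

Bin-map : ∀ (f : ℕ → ℕ) → (∀ x → Bin [ f x ] ≡ true) → ∀ a → Bin (map f a) ≡ true
Bin-map f bits [] = refl
Bin-map f bits (x ∷ a) = Bin-join [ f x ] (map f a) (bits x) (Bin-map f bits a)

bitPath : ∀ (β : Path) → (∀ i → Bin [ β i ] ≡ true) → IsPathOf Bin β
bitPath β bits n = Bin-map β bits (upTo n)

clamp : ℕ → ℕ
clamp zero = 0
clamp (suc zero) = 1
clamp (suc (suc _)) = 0

clamp-bit : ∀ x → Bin [ clamp x ] ≡ true
clamp-bit zero = refl
clamp-bit (suc zero) = refl
clamp-bit (suc (suc _)) = refl

clamp-binary : ∀ a → Bin a ≡ true → map clamp a ≡ a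
clamp-binary [] _ = refl
clamp-binary (zero ∷ a) p = cong (0 ∷_) (clamp-binary a p)
clamp-binary (suc zero ∷ a) p = cong (1 ∷_) (clamp-binary a p)
clamp-binary (suc (suc _) ∷ a) ()

clamp-initSeg : ∀ (α : Path) n → Bin (initSeg α n) ≡ true → initSeg (clamp ∘ α) n ≡ initSeg α n
clamp-initSeg α n p = trans (map-∘ (upTo n)) (clamp-binary (initSeg α n) p)

-- Given a family B of decidable sets, marker B c is false exactly when
-- c = a * ⟨n+2⟩ with a binary and a ∉ Bₙ: the first non-binary entry acts as a marker
-- asking "is the binary sequence before me in Bₙ?", and everything after it is accepted.

shift : Seq → (ℕ → DecSet) → (ℕ → DecSet)
shift a B n b = B n (a ++ b)

atMarker : Bool → Seq → Bool
atMarker v [] = v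
atMarker v (_ ∷ _) = true

marker : (ℕ → DecSet) → DecSet
marker B [] = true
marker B (zero ∷ c) = marker (shift [ 0 ] B) c
marker B (suc zero ∷ c) = marker (shift [ 1 ] B) c
marker B (suc (suc n) ∷ c) = atMarker (B n []) c

marker-++ : ∀ B a c → Bin a ≡ true → marker B (a ++ c) ≡ marker (shift a B) c
marker-++ B [] c _ = refl
marker-++ B (zero ∷ a) c p = marker-++ (shift [ 0 ] B) a c p
marker-++ B (suc zero ∷ a) c p = marker-++ (shift [ 1 ] B) a c p
marker-++ B (suc (suc _) ∷ a) c ()

marker-at : ∀ B a n → Bin a ≡ true → marker B (a ++ [ suc (suc n) ]) ≡ B n a
marker-at B a n p = trans (marker-++ B a [ suc (suc n) ] p) (cong (B n) (++-identityʳ a))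

marker-true : ∀ B → (∀ n b → Bin b ≡ true → B n b ≡ true) → ∀ c → marker B c ≡ true
marker-true B h [] = refl
marker-true B h (zero ∷ c) = marker-true (shift [ 0 ] B) (λ n b → h n (0 ∷ b)) c
marker-true B h (suc zero ∷ c) = marker-true (shift [ 1 ] B) (λ n b → h n (1 ∷ b)) c
marker-true B h (suc (suc n) ∷ []) = h n [] refl
marker-true B h (suc (suc n) ∷ _ ∷ _) = refl

marker-beyond : ∀ B c y r → Bin c ≡ false → marker B (c ++ y ∷ r) ≡ true
marker-beyond B [] y r ()
marker-beyond B (zero ∷ c) y r p = marker-beyond (shift [ 0 ] B) c y r p
marker-beyond B (suc zero ∷ c) y r p = marker-beyond (shift [ 1 ] B) c y r p
marker-beyond B (suc (suc n) ∷ []) y r _ = refl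
marker-beyond B (suc (suc n) ∷ _ ∷ _) y r _ = refl

markerOf : ∀ {P} → IsΠ⁰₁ Bin P → DecSet
markerOf (B , _) = marker B

-- For monotone P the marker test exhibits P as a c-set of the binary fan: a binary node a
-- is in P = ⋂ Bₙ iff no extension of a fails the test (monotonicity makes the markers placed
-- after longer binary extensions a * b harmless).
markerOf-spec : ∀ {P} → IsMonotone Bin P → (π : IsΠ⁰₁ Bin P) →
                ∀ a → Bin a ≡ true → P a ⇔ (∀ c → markerOf π (a ++ c) ≡ true)
markerOf-spec {P} mono (B , _ , P⇔⋂B) a binA = mk⇔ sound complete
  where
  sound : P a → ∀ c → marker B (a ++ c) ≡ true
  sound pa c = trans (marker-++ B a c binA) (marker-true (shift a B) inB c)
    where
    inB : ∀ n b → Bin b ≡ true → B n (a ++ b) ≡ true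
    inB n b binB = to (P⇔⋂B (a ++ b)) (mono a b pa (Bin-join a b binA binB)) n

  complete : (∀ c → marker B (a ++ c) ≡ true) → P a
  complete h = from (P⇔⋂B a) (λ n → trans (sym (marker-at B a n binA)) (h [ suc (suc n) ]))

Π⁰₁-⊆ : ∀ {S P} → IsΠ⁰₁ S P → P ⊆ S
Π⁰₁-⊆ (_ , B⊆S , P⇔⋂B) a pa = B⊆S 0 a (to (P⇔⋂B a) pa 0)

monotoneΠ⁰₁⇒cSet : ∀ {P} → IsMonotone Bin P → IsΠ⁰₁ Bin P → IsCSet Bin P
monotoneΠ⁰₁⇒cSet mono π = Π⁰₁-⊆ π , markerOf π , markerOf-spec mono π

restrict-cBar : ∀ {S P} → IsCBar Univ P → IsCBar S (P ∩ S)
restrict-cBar {S} {P} ((_ , D , P⇔D) , (_ , bar)) = (P∩S⊆S , D , P∩S⇔D) , (P∩S⊆S , bar-S)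
  where
  P∩S⊆S : (P ∩ S) ⊆ S
  P∩S⊆S _ = proj₂
  P∩S⇔D : ∀ a → a ∈ᵈ S → ((P ∩ S) a ⇔ (∀ b → (a ++ b) ∈ᵈ D))
  P∩S⇔D a a∈S = mk⇔ (to (P⇔D a refl) ∘ proj₁) (λ d → from (P⇔D a refl) d , a∈S)
  bar-S : ∀ α → IsPathOf S α → ∃[ n ] (P ∩ S) (initSeg α n)
  bar-S α α∈S = let (n , pn) = bar α (λ _ → refl) in n , pn , α∈S n

-- Bounded search.  "∀ b, f b" for decidable f is Π⁰₁: its n-th approximation checks f on
-- the finitely many sequences of length ≤ n with entries ≤ n.

allUpTo : ℕ → (ℕ → Bool) → Bool
allUpTo zero g = g 0
allUpTo (suc m) g = allUpTo m g ∧ g (suc m)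

allUpTo-intro : ∀ m g → (∀ x → g x ≡ true) → allUpTo m g ≡ true
allUpTo-intro zero g h = h 0
allUpTo-intro (suc m) g h = ∧-intro (allUpTo-intro m g h) (h (suc m))

allUpTo-elim : ∀ m g x → allUpTo m g ≡ true → x ≤ m → g x ≡ true
allUpTo-elim zero g .zero p z≤n = p
allUpTo-elim (suc m) g x p x≤ with m≤n⇒m<n∨m≡n x≤
... | inj₁ (s≤s x≤m) = allUpTo-elim m g x (∧-conicalˡ _ _ p) x≤m
... | inj₂ refl = ∧-conicalʳ (allUpTo m g) _ p

boundedAll : ℕ → ℕ → DecSet → Bool
boundedAll zero m f = f []
boundedAll (suc d) m f = f [] ∧ allUpTo m (λ x → boundedAll d m (f ∘ (x ∷_)))

boundedAll-intro : ∀ d m f → (∀ b → f b ≡ true) → boundedAll d m f ≡ true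
boundedAll-intro zero m f h = h []
boundedAll-intro (suc d) m f h =
  ∧-intro (h []) (allUpTo-intro m _ (λ x → boundedAll-intro d m (f ∘ (x ∷_)) (h ∘ (x ∷_))))

boundedAll-elim : ∀ d m f b → boundedAll d m f ≡ true → length b ≤ d → All (_≤ m) b → f b ≡ true
boundedAll-elim zero m f [] p _ _ = p
boundedAll-elim (suc d) m f [] p _ _ = ∧-conicalˡ _ _ p
boundedAll-elim (suc d) m f (x ∷ b) p (s≤s len≤d) (x≤m ∷ b≤m) =
  boundedAll-elim d m (f ∘ (x ∷_)) b (allUpTo-elim m _ x (∧-conicalʳ (f []) _ p) x≤m) len≤d b≤m

-- a common bound for the length and the entries of a sequence
size : Seq → ℕ
size [] = 0
size (x ∷ b) = suc (x + size b)

length≤size : ∀ b → length b ≤ size b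
length≤size [] = z≤n
length≤size (x ∷ b) = s≤s (≤-trans (length≤size b) (m≤n+m (size b) x))

entries≤size : ∀ b → All (_≤ size b) b
entries≤size [] = []
entries≤size (x ∷ b) = ≤-trans (m≤m+n x (size b)) (n≤1+n _)
                     ∷ All.map (λ y≤ → ≤-trans y≤ (≤-trans (m≤n+m (size b) x) (n≤1+n _))) (entries≤size b)

∀seq⇔bounded : ∀ f → (∀ b → f b ≡ true) ⇔ (∀ n → boundedAll n n f ≡ true)
∀seq⇔bounded f = mk⇔ (λ h n → boundedAll-intro n n f h)
  (λ h b → boundedAll-elim (size b) (size b) f b (h (size b)) (length≤size b) (entries≤size b))

caseOn : ∀ {A : Set} (S : DecSet) a b → S a ≡ b → (a ∈ᵈ S → A) → A → A
caseOn S a true  a∈S inS outS = inS a∈S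
caseOn S a false _   inS outS = outS

caseᵈ : ∀ {A : Set} (S : DecSet) a → (a ∈ᵈ S → A) → A → A
caseᵈ S a = caseOn S a (S a) refl

caseᵈ-elim : ∀ {A : Set} (S : DecSet) a (inS : a ∈ᵈ S → A) (outS : A) (R : A → Set) →
             (∀ a∈S → R (inS a∈S)) → (S a ≡ false → R outS) → R (caseᵈ S a inS outS)
caseᵈ-elim S a inS outS R rIn rOut = elim (S a) refl
  where
  elim : ∀ b (e : S a ≡ b) → R (caseOn S a b e inS outS)
  elim true  a∈S = rIn a∈S
  elim false a∉S = rOut a∉S

-- The branching bounds of a fan T combine into one bound M n on the n-th
-- value of every path: if all values below n are ≤ E n, the node ᾱn is one of finitely many
-- sequences, so α n is bounded by the largest branching bound among them.

maxUpTo : ℕ → (ℕ → ℕ) → ℕ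
maxUpTo zero g = g 0
maxUpTo (suc m) g = maxUpTo m g ⊔ g (suc m)

maxUpTo-ub : ∀ m g x → x ≤ m → g x ≤ maxUpTo m g
maxUpTo-ub zero g .zero z≤n = ≤-refl
maxUpTo-ub (suc m) g x x≤ with m≤n⇒m<n∨m≡n x≤
... | inj₁ (s≤s x≤m) = ≤-trans (maxUpTo-ub m g x x≤m) (m≤m⊔n _ _)
... | inj₂ refl = m≤n⊔m (maxUpTo m g) (g (suc m))

maxOverSeqs : ℕ → ℕ → (Seq → ℕ) → ℕ
maxOverSeqs zero m f = f []
maxOverSeqs (suc d) m f = maxUpTo m (λ x → maxOverSeqs d m (f ∘ (x ∷_)))

maxOverSeqs-ub : ∀ m f a → All (_≤ m) a → f a ≤ maxOverSeqs (length a) m f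
maxOverSeqs-ub m f [] [] = ≤-refl
maxOverSeqs-ub m f (x ∷ a) (x≤m ∷ a≤m) =
  ≤-trans (maxOverSeqs-ub m (f ∘ (x ∷_)) a a≤m)
          (maxUpTo-ub m (λ y → maxOverSeqs (length a) m (f ∘ (y ∷_))) x x≤m)

module LevelBound (T : DecSet) (fanT : IsFan T) where
  private
    closed : ∀ a b → (a ++ b) ∈ᵈ T → a ∈ᵈ T
    closed = proj₂ (proj₁ (proj₁ fanT))

  -- the branching bound of a node, 0 off the fan
  branchBound : Seq → ℕ
  branchBound t = caseᵈ T t (λ t∈T → proj₁ (proj₂ fanT t t∈T)) 0

  branchBound-spec : ∀ t x → (t ++ [ x ]) ∈ᵈ T → x ≤ branchBound t
  branchBound-spec t x tx∈T = caseᵈ-elim T t _ 0 (x ≤_)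
    (λ t∈T → proj₂ (proj₂ fanT t t∈T) x tx∈T)
    (λ t∉T → contradiction (trans (sym t∉T) (closed t [ x ] tx∈T)) λ ())

  mutual
    -- E n bounds the values below n, M n the value at n
    E : ℕ → ℕ
    E zero = 0
    E (suc n) = E n ⊔ M n

    M : ℕ → ℕ
    M n = maxOverSeqs n (E n) branchBound

  module _ (α : Path) (α∈T : IsPathOf T α) where
    mutual
      below-E : ∀ n i → i < n → α i ≤ E n
      below-E (suc n) i (s≤s i≤n) with m≤n⇒m<n∨m≡n i≤n
      ... | inj₁ i<n = ≤-trans (below-E n i i<n) (m≤m⊔n (E n) (M n))
      ... | inj₂ refl = ≤-trans (at-M i) (m≤n⊔m (E i) (M i))

      at-M : ∀ n → α n ≤ M n
      at-M n = ≤-trans (branchBound-spec (initSeg α n) (α n) (subst (_∈ᵈ T) (initSeg-suc α n) (α∈T (suc n))))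
                       (subst (λ d → branchBound (initSeg α n) ≤ maxOverSeqs d (E n) branchBound)
                              (length-initSeg α n)
                              (maxOverSeqs-ub (E n) branchBound (initSeg α n) (All-initSeg α n (below-E n))))

-- Shadowing a sequence in a spread.  Any δ determines a path γ of the spread S which copies
-- δ for as long as the initial segments of δ stay in S.
module Shadow (S : DecSet) (spreadS : IsSpread S) (δ : Path) where
  private
    closed : ∀ a b → (a ++ b) ∈ᵈ S → a ∈ᵈ S
    closed = proj₂ (proj₁ spreadS)

    []∈S : [] ∈ᵈ S
    []∈S = let (a , a∈S) = proj₁ (proj₁ spreadS) in closed [] a a∈S

  anyNext : Seq → ℕ
  anyNext t = caseᵈ S t (λ t∈S → proj₁ (proj₂ spreadS t t∈S)) 0

  anyNext-spec : ∀ t → t ∈ᵈ S → (t ++ [ anyNext t ]) ∈ᵈ S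
  anyNext-spec t t∈S = caseᵈ-elim S t _ 0 (λ x → (t ++ [ x ]) ∈ᵈ S)
    (λ t∈S' → proj₂ (proj₂ spreadS t t∈S'))
    (λ t∉S → contradiction (trans (sym t∉S) t∈S) λ ())

  next : ℕ → Seq → ℕ
  next n t = caseᵈ S (t ++ [ δ n ]) (λ _ → δ n) (anyNext t)

  next-spec : ∀ n t → t ∈ᵈ S → (t ++ [ next n t ]) ∈ᵈ S
  next-spec n t t∈S = caseᵈ-elim S (t ++ [ δ n ]) _ (anyNext t) (λ x → (t ++ [ x ]) ∈ᵈ S)
    id (λ _ → anyNext-spec t t∈S)

  next-copies : ∀ n t → (t ++ [ δ n ]) ∈ᵈ S → next n t ≡ δ n
  next-copies n t tδ∈S = caseᵈ-elim S (t ++ [ δ n ]) _ (anyNext t) (_≡ δ n)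
    (λ _ → refl) (λ tδ∉S → contradiction (trans (sym tδ∉S) tδ∈S) λ ())

  node : ℕ → Seq
  node zero = []
  node (suc n) = node n ++ [ next n (node n) ]

  γ : Path
  γ n = next n (node n)

  initSeg-γ : ∀ n → initSeg γ n ≡ node n
  initSeg-γ zero = refl
  initSeg-γ (suc n) = trans (initSeg-suc γ n) (cong (_++ [ γ n ]) (initSeg-γ n))

  γ-path : IsPathOf S γ
  γ-path n = subst (_∈ᵈ S) (sym (initSeg-γ n)) (node∈S n)
    where
    node∈S : ∀ n → node n ∈ᵈ S
    node∈S zero = []∈S
    node∈S (suc n) = next-spec n (node n) (node∈S n)

  copies : ∀ k → initSeg δ k ∈ᵈ S → initSeg δ k ≡ initSeg γ k
  copies zero _ = refl
  copies (suc k) δsk∈S = begin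
    initSeg δ (suc k)        ≡⟨ initSeg-suc δ k ⟩
    initSeg δ k ++ [ δ k ]   ≡⟨ cong₂ (λ u x → u ++ [ x ]) shorter (sym (next-copies k (node k) nodeδ∈S)) ⟩
    initSeg γ k ++ [ γ k ]   ≡⟨ initSeg-suc γ k ⟨
    initSeg γ (suc k)        ∎
    where
    δkδ∈S : (initSeg δ k ++ [ δ k ]) ∈ᵈ S
    δkδ∈S = subst (_∈ᵈ S) (initSeg-suc δ k) δsk∈S

    shorter : initSeg δ k ≡ initSeg γ k
    shorter = copies k (closed (initSeg δ k) [ δ k ] δkδ∈S)

    nodeδ∈S : (node k ++ [ δ k ]) ∈ᵈ S
    nodeδ∈S = subst (λ u → (u ++ [ δ k ]) ∈ᵈ S) (trans shorter (initSeg-γ k)) δkδ∈S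

sumBelow : ℕ → (ℕ → ℕ) → ℕ
sumBelow zero f = 0
sumBelow (suc L) f = sumBelow L f + f L

sumBelow-cong : ∀ L f g → (∀ j → j < L → f j ≡ g j) → sumBelow L f ≡ sumBelow L g
sumBelow-cong zero f g _ = refl
sumBelow-cong (suc L) f g f≐g = cong₂ _+_ (sumBelow-cong L f g (λ j j<L → f≐g j (m<n⇒m<1+n j<L))) (f≐g L (n<1+n L))

unaryDigit : ℕ → ℕ → ℕ
unaryDigit x j with j <? x
... | yes _ = 1
... | no _ = 0

unaryDigit-bit : ∀ x j → Bin [ unaryDigit x j ] ≡ true
unaryDigit-bit x j with j <? x
... | yes _ = refl
... | no _ = refl

sumBelow-unaryDigit : ∀ L x → sumBelow L (unaryDigit x) ≡ L ⊓ x
sumBelow-unaryDigit zero x = refl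
sumBelow-unaryDigit (suc L) x with L <? x
... | yes L<x = begin
  sumBelow L (unaryDigit x) + 1  ≡⟨ cong (_+ 1) (sumBelow-unaryDigit L x) ⟩
  L ⊓ x + 1                      ≡⟨ cong (_+ 1) (m≤n⇒m⊓n≡m (<⇒≤ L<x)) ⟩
  L + 1                          ≡⟨ +-comm L 1 ⟩
  suc L                          ≡⟨ m≤n⇒m⊓n≡m L<x ⟨
  suc L ⊓ x                      ∎
... | no L≮x = begin
  sumBelow L (unaryDigit x) + 0  ≡⟨ +-identityʳ _ ⟩
  sumBelow L (unaryDigit x)      ≡⟨ sumBelow-unaryDigit L x ⟩
  L ⊓ x                          ≡⟨ m≥n⇒m⊓n≡n x≤L ⟩
  x                              ≡⟨ m≥n⇒m⊓n≡n (m≤n⇒m≤1+n x≤L) ⟨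
  suc L ⊓ x                      ∎
  where
  x≤L : x ≤ L
  x≤L = ≮⇒≥ L≮x

-- Fix bounds M i and cut ℕ into consecutive blocks, block i consisting of the
-- M i + 1 positions start i, …, start i + M i.  A binary sequence decodes to the numbers of
-- ones in its completed blocks; conversely every α with α i ≤ M i is the decoding of the
-- binary path writing α i in unary in block i.
module BlockCode (M : ℕ → ℕ) where
  start : ℕ → ℕ
  start zero = 0
  start (suc i) = start i + suc (M i)

  start-< : ∀ i → start i < start (suc i)
  start-< i = m<m+n (start i) z<s

  start-mono : ∀ {i j} → i ≤ j → start i ≤ start j
  start-mono {i} {zero} z≤n = ≤-refl
  start-mono {i} {suc j} i≤ with m≤n⇒m<n∨m≡n i≤
  ... | inj₁ (s≤s i≤j) = ≤-trans (start-mono i≤j) (<⇒≤ (start-< j))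
  ... | inj₂ refl = ≤-refl

  start-≥ : ∀ i → i ≤ start i
  start-≥ zero = z≤n
  start-≥ (suc i) = ≤-trans (s≤s (start-≥ i)) (start-< i)

  -- the block containing position L, i.e. the number of blocks completed before L
  blocks : ℕ → ℕ
  blocks zero = 0
  blocks (suc L) with start (suc (blocks L)) ≤? suc L
  ... | yes _ = suc (blocks L)
  ... | no _ = blocks L

  blocks-spec : ∀ L → start (blocks L) ≤ L × L < start (suc (blocks L))
  blocks-spec zero = z≤n , start-< 0
  blocks-spec (suc L) with start (suc (blocks L)) ≤? suc L | blocks-spec L
  ... | yes started | _ , inBlock = started , ≤-<-trans inBlock (start-< (suc (blocks L)))
  ... | no notStarted | started , _ = m≤n⇒m≤1+n started , ≰⇒> notStarted

  blocks-unique : ∀ L i → start i ≤ L → L < start (suc i) → blocks L ≡ i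
  blocks-unique L i started inBlock with <-cmp (blocks L) i
  ... | tri< b<i _ _ = contradiction (≤-trans (start-mono b<i) started) (<⇒≱ (proj₂ (blocks-spec L)))
  ... | tri≈ _ b≡i _ = b≡i
  ... | tri> _ _ i<b = contradiction (≤-trans (start-mono i<b) (proj₁ (blocks-spec L))) (<⇒≱ inBlock)

  blocks-≤ : ∀ L → blocks L ≤ L
  blocks-≤ L = ≤-trans (start-≥ (blocks L)) (proj₁ (blocks-spec L))

  blocks-mono : ∀ {L L'} → L ≤ L' → blocks L ≤ blocks L'
  blocks-mono {L} {L'} L≤L' = ≮⇒≥ λ b'<b →
    <⇒≱ (proj₂ (blocks-spec L')) (≤-trans (start-mono b'<b) (≤-trans (proj₁ (blocks-spec L)) L≤L'))

  inside : ∀ L i j → i < blocks L → j < suc (M i) → start i + j < L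
  inside L i j i<b j≤ = <-≤-trans (+-monoʳ-< (start i) j≤) (≤-trans (start-mono i<b) (proj₁ (blocks-spec L)))

  blockSum : Path → ℕ → ℕ
  blockSum f i = sumBelow (suc (M i)) (λ j → f (start i + j))

  decode : Seq → Seq
  decode a = initSeg (blockSum (nth a)) (blocks (length a))

  -- decoding ᾱm only depends on the completed blocks, all of which lie inside ᾱm
  decode-initSeg : ∀ β m → decode (initSeg β m) ≡ initSeg (blockSum β) (blocks m)
  decode-initSeg β m rewrite length-initSeg β m =
    initSeg-cong _ _ (blocks m) λ i i<b →
      sumBelow-cong (suc (M i)) _ _ λ j j≤ → nth-initSeg β m (start i + j) (inside m i j i<b j≤)

  decode-++ : ∀ a b → ∃[ e ] decode (a ++ b) ≡ decode a ++ e
  decode-++ a b =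
    let (e , eq) = initSeg-prefix (blockSum (nth (a ++ b))) (blocks-mono a≤ab) in
    e , trans eq (cong (_++ e) (initSeg-cong _ _ (blocks (length a)) λ i i<b →
          sumBelow-cong (suc (M i)) _ _ λ j j≤ → nth-++ a b (start i + j) (inside (length a) i j i<b j≤)))
    where
    a≤ab : length a ≤ length (a ++ b)
    a≤ab = subst (length a ≤_) (sym (length-++ a)) (m≤m+n (length a) (length b))

  encode : Path → Path
  encode α p = unaryDigit (α (blocks p)) (p ∸ start (blocks p))

  encode-bit : ∀ α p → Bin [ encode α p ] ≡ true
  encode-bit α p = unaryDigit-bit (α (blocks p)) (p ∸ start (blocks p))

  blockSum-encode : ∀ α i → α i ≤ M i → blockSum (encode α) i ≡ α i
  blockSum-encode α i αi≤ = begin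
    blockSum (encode α) i                   ≡⟨ sumBelow-cong (suc (M i)) _ _ inBlock ⟩
    sumBelow (suc (M i)) (unaryDigit (α i)) ≡⟨ sumBelow-unaryDigit (suc (M i)) (α i) ⟩
    suc (M i) ⊓ α i                         ≡⟨ m≥n⇒m⊓n≡n (m≤n⇒m≤1+n αi≤) ⟩
    α i                                     ∎
    where
    inBlock : ∀ j → j < suc (M i) → encode α (start i + j) ≡ unaryDigit (α i) j
    inBlock j j≤ rewrite blocks-unique (start i + j) i (m≤m+n (start i) j) (+-monoʳ-< (start i) j≤)
                       | m+n∸m≡n (start i) j = refl

-- A c-set of a tree is monotone: its witness D speaks about all extensions at once.
cSet-monotone : ∀ {S P} → IsCSet S P → IsMonotone S P
cSet-monotone (P⊆S , D , P⇔D) a b pa ab∈S = from (P⇔D (a ++ b) ab∈S) λ c →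
  subst (_∈ᵈ D) (sym (++-assoc a b c)) (to (P⇔D a (P⊆S a pa)) pa (b ++ c))

-- Given a c-bar P of a fan T, code T into the binary fan by BlockCode with the
-- level bounds M of T, and let Q be the set of binary codes whose decoding has either left T
-- or entered P.  Q is a monotone Π⁰₁ bar of {0,1}*, so by (1) it is uniform with some bound N;
-- since the code of a path α of T decodes back to α, and the decoding of a segment of length
-- n ≤ N has length ≤ n, P bars every path of T below N.
module FanToBinary (T : DecSet) (fanT : IsFan T) (P : Subset) (cbar : IsCBar T P) where
  open LevelBound T fanT using (M; at-M)
  open BlockCode M

  private
    closed : ∀ a b → (a ++ b) ∈ᵈ T → a ∈ᵈ T
    closed = proj₂ (proj₁ (proj₁ fanT))

    P⊆T : P ⊆ T
    P⊆T = proj₁ (proj₁ cbar)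

    D : DecSet
    D = proj₁ (proj₂ (proj₁ cbar))

    P⇔D : ∀ a → a ∈ᵈ T → (P a ⇔ (∀ b → (a ++ b) ∈ᵈ D))
    P⇔D = proj₂ (proj₂ (proj₁ cbar))

  Settled : Seq → Set
  Settled t = T t ≡ false ⊎ P t

  Settled-++ : ∀ t e → Settled t → Settled (t ++ e)
  Settled-++ t e settled with T (t ++ e) in te∈T | settled
  ... | false | _ = inj₁ refl
  ... | true | inj₁ t∉T = contradiction (trans (sym t∉T) (closed t e te∈T)) λ ()
  ... | true | inj₂ pt = inj₂ (cSet-monotone (proj₁ cbar) t e pt te∈T)

  -- Settled is Π⁰₁, approximated by bounded searches for a counterexample to D
  settledUpTo : ℕ → DecSet
  settledUpTo n t = not (T t) ∨ boundedAll n n (λ c → D (t ++ c))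

  Settled⇔ : ∀ t → Settled t ⇔ (∀ n → settledUpTo n t ≡ true)
  Settled⇔ t = mk⇔ approximate limit
    where
    approximate : Settled t → ∀ n → settledUpTo n t ≡ true
    approximate (inj₁ t∉T) n rewrite t∉T = refl
    approximate (inj₂ pt) n rewrite P⊆T t pt =
      to (∀seq⇔bounded (λ c → D (t ++ c))) (to (P⇔D t (P⊆T t pt)) pt) n

    limit : (∀ n → settledUpTo n t ≡ true) → Settled t
    limit h with T t in t∈T
    ... | false = inj₁ refl
    ... | true = inj₂ (from (P⇔D t t∈T) (from (∀seq⇔bounded (λ c → D (t ++ c))) h))

  Q : Subset
  Q a = Bin a ≡ true × Settled (decode a)

  Q-monotone : IsMonotone Bin Q
  Q-monotone a b (_ , settled) ab∈Bin =
    let (e , eq) = decode-++ a b in ab∈Bin , subst Settled (sym eq) (Settled-++ (decode a) e settled)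

  Q-Π⁰₁ : IsΠ⁰₁ Bin Q
  Q-Π⁰₁ = (λ n a → Bin a ∧ settledUpTo n (decode a))
        , (λ n a → ∧-conicalˡ _ _)
        , λ a → mk⇔ (λ (a∈Bin , settled) n → ∧-intro a∈Bin (to (Settled⇔ (decode a)) settled n))
                    (λ h → ∧-conicalˡ _ _ (h 0) , from (Settled⇔ (decode a)) (λ n → ∧-conicalʳ (Bin a) _ (h n)))

  -- Q is a bar: a binary β decodes to δ = blockSum β.  Let γ be the path of T shadowing δ and
  -- k with P (γ̄k).  The code segment β̄(start k) decodes to δ̄k, which is settled: either it
  -- has left T, or it is a node of T and then equals γ̄k ∈ P.
  Q-bar : IsBar Bin Q
  Q-bar = (λ _ → proj₁) , bar
    where
    bar : ∀ β → IsPathOf Bin β → ∃[ n ] Q (initSeg β n)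
    bar β β∈Bin = start k , β∈Bin (start k) , subst Settled (sym decodes) settled
      where
      δ : Path
      δ = blockSum β

      open Shadow T (proj₁ fanT) δ using (γ; γ-path; copies)

      k : ℕ
      k = proj₁ (proj₂ (proj₂ cbar) γ γ-path)

      decodes : decode (initSeg β (start k)) ≡ initSeg δ k
      decodes = trans (decode-initSeg β (start k)) (cong (initSeg δ) (blocks-unique (start k) k ≤-refl (start-< k)))

      settled : Settled (initSeg δ k)
      settled with T (initSeg δ k) in δk∈T
      ... | false = inj₁ refl
      ... | true = inj₂ (subst P (sym (copies k δk∈T)) (proj₂ (proj₂ (proj₂ cbar) γ γ-path)))

  uniform : IsUniformBar Bin Q → IsUniformBar T P
  uniform (_ , N , Q-uniform) = P⊆T , N , bounded
    where
    bounded : ∀ α → IsPathOf T α → ∃[ n ] (n ≤ N × P (initSeg α n))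
    bounded α α∈T with Q-uniform (encode α) (bitPath (encode α) (encode-bit α))
    ... | n , n≤N , _ , settled = blocks n , ≤-trans (blocks-≤ n) n≤N , inP (subst Settled decodes settled)
      where
      decodes : decode (initSeg (encode α) n) ≡ initSeg α (blocks n)
      decodes = trans (decode-initSeg (encode α) n)
                      (initSeg-cong _ _ (blocks n) λ i _ → blockSum-encode α i (at-M α α∈T i))

      inP : Settled (initSeg α (blocks n)) → P (initSeg α (blocks n))
      inP (inj₁ αn∉T) = contradiction (trans (sym αn∉T) (α∈T (blocks n))) λ ()
      inP (inj₂ p) = p

1⇒3 : Principle1 → Principle3
1⇒3 binary-thm T fanT P cbar = uniform (binary-thm Q Q-monotone Q-Π⁰₁ Q-bar)
  where open FanToBinary T fanT P cbar

2⇒1 : Principle2 → Principle1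
2⇒1 fan-thm P mono π bar = fan-thm P (monotoneΠ⁰₁⇒cSet mono π , bar)

3⇒2 : Principle3 → Principle2
3⇒2 fan-thm = fan-thm Bin binFan

3⇒4 : Principle3 → Principle4
3⇒4 fan-thm T fanT P cbar = fan-thm T fanT (P ∩ T) (restrict-cBar cbar)

-- (4) ⇒ (1): extend a monotone Π⁰₁ bar P of {0,1}* to the c-bar P' of ℕ* cut out by the
-- marker test.  P' bars every α: either ᾱn leaves {0,1}* (and P' holds beyond it) or ᾱn is
-- an initial segment of the binary path clamp ∘ α, which P bars.  On {0,1}*, P' is P.
4⇒1 : Principle4 → Principle1
4⇒1 fan-thm P mono π (P⊆Bin , bar) = P⊆Bin , N , bounded
  where
  D : DecSet
  D = markerOf π

  P' : Subset
  P' a = ∀ c → (a ++ c) ∈ᵈ D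

  bar' : ∀ α → IsPathOf Univ α → ∃[ n ] P' (initSeg α n)
  bar' α _ with bar (clamp ∘ α) (bitPath (clamp ∘ α) (clamp-bit ∘ α))
  ... | n , pn with Bin (initSeg α n) in binSeg
  ...   | true = n , to (markerOf-spec mono π (initSeg α n) binSeg)
                         (subst P (clamp-initSeg α n binSeg) pn)
  ...   | false = suc n , beyond
    where
    beyond : P' (initSeg α (suc n))
    beyond c = begin
      D (initSeg α (suc n) ++ c)        ≡⟨ cong (λ a → D (a ++ c)) (initSeg-suc α n) ⟩
      D ((initSeg α n ++ [ α n ]) ++ c) ≡⟨ cong D (++-assoc (initSeg α n) [ α n ] c) ⟩
      D (initSeg α n ++ α n ∷ c)        ≡⟨ marker-beyond (proj₁ π) (initSeg α n) (α n) c binSeg ⟩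
      true                              ∎

  uniform' : UniformWrt Bin P'
  uniform' = fan-thm Bin binFan P' (((λ _ _ → refl) , D , λ _ _ → mk⇔ id id) , ((λ _ _ → refl) , bar'))

  N : ℕ
  N = proj₁ (proj₂ uniform')

  bounded : ∀ α → IsPathOf Bin α → ∃[ n ] (n ≤ N × P (initSeg α n))
  bounded α α∈Bin =
    let (n , n≤N , p'n , binSeg) = proj₂ (proj₂ uniform') α α∈Bin
    in n , n≤N , from (markerOf-spec mono π (initSeg α n) binSeg) p'n

proposition3p5 : (Principle1 ⇔ Principle2) × (Principle1 ⇔ Principle3) × (Principle1 ⇔ Principle4)
proposition3p5 = mk⇔ (3⇒2 ∘ 1⇒3) 2⇒1
               , mk⇔ 1⇒3 (2⇒1 ∘ 3⇒2)
               , mk⇔ (3⇒4 ∘ 1⇒3) 4⇒1
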